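{- Let $(\mathbb{A},\mathcal{A})$, $(\mathbb{B},\mathcal{B})$, $(\mathbb{C},\mathcal{C})$ be kits. If $P:(\mathbb{A},\mathcal{A})\to(\mathbb{B},\mathcal{B})$ and $Q:(\mathbb{B},\mathcal{B})\to(\mathbb{C},\mathcal{C})$ are stabilized profunctors, then their composite $Q\circ P$, given by $(Q\circ P)(c,a)=\int^{b\in\mathbb{B}}P(b,a)\times Q(c,b)$, is a stabilized profunctor $(\mathbb{A},\mathcal{A})\to(\mathbb{C},\mathcal{C})$.
   Context: A kit on a groupoid $\mathbb{A}$ is a family $\mathcal{A}=\{\mathcal{A}(a)\}_{a\in\mathbb{A}}$ where $\mathcal{A}(a)$ is a set of subgroups of $\mathrm{End}(a)=\mathbb{A}(a,a)$, closed under conjugation ($\alpha^{ -1}G\alpha\in\mathcal{A}(a')$ for $\alpha:a'\to a$, $G\in\mathcal{A}(a)$). Subgroups $H,K$ of $\mathrm{End}(a)$ (identifying $\mathrm{End}_{\mathbb{A}^{op}}(a)$ with the same set) are orthogonal if $H\cap K=\{\mathrm{id}_a\}$; $\mathcal{A}^\perp$ is the kit on $\mathbb{A}^{op}$ with $\mathcal{A}^\perp(a)$ the subgroups orthogonal to every member of $\mathcal{A}(a)$. $\bigcup\mathcal{A}(a)$ is the union of the members of $\mathcal{A}(a)$. A profunctor $P:\mathbb{A}\to\mathbb{B}$ is a functor $\mathbb{B}^{op}\times\mathbb{A}\to\mathbf{Set}$, with $\alpha\cdot p=P(\mathrm{id},\alpha)(p)$ and $p\cdot\beta=P(\beta,\mathrm{id})(p)$.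 It is a stabilized profunctor $(\mathbb{A},\mathcal{A})\to(\mathbb{B},\mathcal{B})$ if for all $a,b$, $p\in P(b,a)$, $\alpha\in\mathrm{End}(a)$, $\beta\in\mathrm{End}(b)$ with $\alpha\cdot p\cdot\beta=p$: $\alpha\in\bigcup\mathcal{A}(a)\Rightarrow\beta\in\bigcup\mathcal{B}(b)$, and $\beta\in\bigcup\mathcal{B}^\perp(b)\Rightarrow\alpha\in\bigcup\mathcal{A}^\perp(a)$. -}

module Defs where

open import Level using (Level; 0ℓ)
open import Data.Product using (Σ; Σ-syntax; _×_; _,_)
open import Relation.Binary.PropositionalEquality using (_≡_)
open import Relation.Binary.Construct.Closure.Equivalence using (EqClosure)

record Groupoid : Set₁ where
  infixr 9 _∘_
  field
    Obj  : Set
    Hom  : Obj → Obj → Set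
    id   : ∀ {a} → Hom a a
    _∘_  : ∀ {a b c} → Hom b c → Hom a b → Hom a c
    inv  : ∀ {a b} → Hom a b → Hom b a
    idˡ  : ∀ {a b} (f : Hom a b) → id ∘ f ≡ f
    idʳ  : ∀ {a b} (f : Hom a b) → f ∘ id ≡ f
    assoc : ∀ {a b c d} (h : Hom c d) (g : Hom b c) (f : Hom a b) →
            (h ∘ g) ∘ f ≡ h ∘ (g ∘ f)
    invˡ : ∀ {a b} (f : Hom a b) → inv f ∘ f ≡ id
    invʳ : ∀ {a b} (f : Hom a b) → f ∘ inv f ≡ id

  End : Obj → Set
  End a = Hom a a

module _ (𝔸 : Groupoid) where
  open Groupoid 𝔸

  record Subgroup (a : Obj) : Set₁ where
    field
      mem     : End a → Set
      mem-id  : mem id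
      mem-∘   : ∀ {g h} → mem g → mem h → mem (g ∘ h)
      mem-inv : ∀ {g} → mem g → mem (inv g)
  open Subgroup public

  -- α⁻¹ G α, for α : a' → a and G ≤ End(a):  h ∈ α⁻¹Gα  iff  α h α⁻¹ ∈ G.
  conj : ∀ {a' a} → Hom a' a → Subgroup a → Subgroup a'
  conj α G = record
    { mem     = λ h → mem G (α ∘ (h ∘ inv α))
    ; mem-id  = mem-id-proof
    ; mem-∘   = λ {g} {h} mg mh → ∘-proof {g} {h} mg mh
    ; mem-inv = λ {g} mg → inv-proof {g} mg
    }
    where
    open import Relation.Binary.PropositionalEquality using (subst; cong; cong₂; sym; trans)
    open import Relation.Binary.PropositionalEquality using (module ≡-Reasoning)
    e-id : α ∘ (id ∘ inv α) ≡ id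
    e-id = trans (cong (α ∘_) (idˡ (inv α))) (invʳ α)
    mem-id-proof : mem G (α ∘ (id ∘ inv α))
    mem-id-proof = subst (mem G) (sym e-id) (mem-id G)
    e-∘ : ∀ g h → (α ∘ (g ∘ inv α)) ∘ (α ∘ (h ∘ inv α)) ≡ α ∘ ((g ∘ h) ∘ inv α)
    e-∘ g h = begin
        (α ∘ (g ∘ inv α)) ∘ (α ∘ (h ∘ inv α))
          ≡⟨ assoc α (g ∘ inv α) _ ⟩
        α ∘ ((g ∘ inv α) ∘ (α ∘ (h ∘ inv α)))
          ≡⟨ cong (α ∘_) (assoc g (inv α) _) ⟩
        α ∘ (g ∘ (inv α ∘ (α ∘ (h ∘ inv α))))
          ≡⟨ cong (λ z → α ∘ (g ∘ z)) (sym (assoc (inv α) α _)) ⟩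
        α ∘ (g ∘ ((inv α ∘ α) ∘ (h ∘ inv α)))
          ≡⟨ cong (λ z → α ∘ (g ∘ (z ∘ (h ∘ inv α)))) (invˡ α) ⟩
        α ∘ (g ∘ (id ∘ (h ∘ inv α)))
          ≡⟨ cong (λ z → α ∘ (g ∘ z)) (idˡ _) ⟩
        α ∘ (g ∘ (h ∘ inv α))
          ≡⟨ cong (α ∘_) (sym (assoc g h (inv α))) ⟩
        α ∘ ((g ∘ h) ∘ inv α) ∎
      where open ≡-Reasoning
    ∘-proof : ∀ {g h} → mem G (α ∘ (g ∘ inv α)) → mem G (α ∘ (h ∘ inv α)) →
              mem G (α ∘ ((g ∘ h) ∘ inv α))
    ∘-proof {g} {h} mg mh = subst (mem G) (e-∘ g h) (mem-∘ G mg mh)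
    -- α g⁻¹ α⁻¹ is the inverse of α g α⁻¹: derive membership via
    -- (α g α⁻¹)⁻¹ ∈ G and uniqueness of inverses.
    inv-proof : ∀ {g} → mem G (α ∘ (g ∘ inv α)) → mem G (α ∘ (inv g ∘ inv α))
    inv-proof {g} mg = subst (mem G) (uniq x y xy) (mem-inv G mg)
      where
      x = α ∘ (g ∘ inv α)
      y = α ∘ (inv g ∘ inv α)
      xy : x ∘ y ≡ id
      xy = trans (e-∘ g (inv g))
                 (trans (cong (λ z → α ∘ (z ∘ inv α)) (invʳ g))
                        e-id)
      uniq : ∀ {b} (x y : End b) → x ∘ y ≡ id → inv x ≡ y
      uniq x y e = begin
          inv x            ≡⟨ sym (idʳ (inv x)) ⟩
          inv x ∘ id       ≡⟨ cong (inv x ∘_) (sym e) ⟩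
          inv x ∘ (x ∘ y)  ≡⟨ sym (assoc (inv x) x y) ⟩
          (inv x ∘ x) ∘ y  ≡⟨ cong (_∘ y) (invˡ x) ⟩
          id ∘ y           ≡⟨ idˡ y ⟩
          y ∎
        where open ≡-Reasoning

  record Kit : Set₂ where
    field
      sub       : (a : Obj) → Subgroup a → Set₁
      conj-closed : ∀ {a' a} (α : Hom a' a) (G : Subgroup a) →
                    sub a G → sub a' (conj α G)
  open Kit public

  Orthogonal : ∀ {a} → Subgroup a → Subgroup a → Set
  Orthogonal {a} H K = ∀ (h : End a) → mem H h → mem K h → h ≡ id

  ⋃ : (𝒜 : Kit) (a : Obj) → End a → Set₁
  ⋃ 𝒜 a α = Σ[ G ∈ Subgroup a ] (sub 𝒜 a G × mem G α)

  -- 𝒜⊥(a): subgroups orthogonal to every member of 𝒜(a).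
  -- (End_{𝔸^op}(a) is identified with End_𝔸(a) as a set; subgroups of the
  --  opposite monoid are the same subsets, so we keep them as Subgroup a.)
  ⊥-sub : Kit → (a : Obj) → Subgroup a → Set₁
  ⊥-sub 𝒜 a H = ∀ (G : Subgroup a) → sub 𝒜 a G → Orthogonal G H

  ⋃⊥ : (𝒜 : Kit) (a : Obj) → End a → Set₁
  ⋃⊥ 𝒜 a α = Σ[ H ∈ Subgroup a ] (⊥-sub 𝒜 a H × mem H α)

-- Profunctors P : 𝔸 → 𝔹, i.e. functors 𝔹^op × 𝔸 → Set.
-- α · p = P(id, α)(p),  p · β = P(β, id)(p).

record Profunctor (𝔸 𝔹 : Groupoid) : Set₁ where
  private
    module A = Groupoid 𝔸
    module B = Groupoid 𝔹
  field
    El   : B.Obj → A.Obj → Set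
    lact : ∀ {b a a'} → A.Hom a a' → El b a → El b a'
    ract : ∀ {b b' a} → El b a → B.Hom b' b → El b' a
    lact-id : ∀ {b a} (p : El b a) → lact A.id p ≡ p
    ract-id : ∀ {b a} (p : El b a) → ract p B.id ≡ p
    lact-∘  : ∀ {b a a' a''} (α' : A.Hom a' a'') (α : A.Hom a a') (p : El b a) →
              lact (α' A.∘ α) p ≡ lact α' (lact α p)
    ract-∘  : ∀ {b b' b'' a} (p : El b a) (β : B.Hom b' b) (β' : B.Hom b'' b') →
              ract p (β B.∘ β') ≡ ract (ract p β) β'
    lact-ract : ∀ {b b' a a'} (α : A.Hom a a') (p : El b a) (β : B.Hom b' b) →
                lact α (ract p β) ≡ ract (lact α p) β
open Profunctor public

-- The stabilization condition, stated for a family of elements with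
-- actions and an equality relation _≈_ on elements (≡ for an ordinary
-- profunctor, the coend's equivalence for a composite).

module _ {𝔸 𝔹 : Groupoid} (𝒜 : Kit 𝔸) (ℬ : Kit 𝔹) where
  private
    module A = Groupoid 𝔸
    module B = Groupoid 𝔹

  StabilizedCond :
    (E : B.Obj → A.Obj → Set)
    (lact : ∀ {b a} → A.End a → E b a → E b a)
    (ract : ∀ {b a} → E b a → B.End b → E b a)
    (_≈_  : ∀ {b a} → E b a → E b a → Set) → Set₁
  StabilizedCond E lact ract _≈_ =
    ∀ (a : A.Obj) (b : B.Obj) (p : E b a) (α : A.End a) (β : B.End b) →
    ract (lact α p) β ≈ p →
      ((⋃ 𝔸 𝒜 a α → ⋃ 𝔹 ℬ b β) × (⋃⊥ 𝔹 ℬ b β → ⋃⊥ 𝔸 𝒜 a α))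

  IsStabilized : Profunctor 𝔸 𝔹 → Set₁
  IsStabilized P = StabilizedCond (El P) (lact P) (ract P) _≡_

-- Composite Q ∘ P of P : 𝔸 → 𝔹 and Q : 𝔹 → ℂ, as the coend
-- (Q∘P)(c,a) = ∫^b P(b,a) × Q(c,b) = (Σ b. P(b,a) × Q(c,b)) / ~
-- where ~ is the equivalence relation generated by
--   (b', p · β, q) ~ (b, p, β · q)   for β : b' → b, p ∈ P(b,a), q ∈ Q(c,b').

module _ {𝔸 𝔹 ℂ : Groupoid} (P : Profunctor 𝔸 𝔹) (Q : Profunctor 𝔹 ℂ) where
  private
    module A = Groupoid 𝔸
    module B = Groupoid 𝔹
    module C = Groupoid ℂ

  CompEl : C.Obj → A.Obj → Set
  CompEl c a = Σ[ b ∈ B.Obj ] (El P b a × El Q c b)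

  data CoendGen {c : C.Obj} {a : A.Obj} : CompEl c a → CompEl c a → Set where
    gen : ∀ {b b'} (β : B.Hom b' b) (p : El P b a) (q : El Q c b') →
          CoendGen (b' , ract P p β , q) (b , p , lact Q β q)

  _≈Comp_ : ∀ {c a} → CompEl c a → CompEl c a → Set
  _≈Comp_ = EqClosure CoendGen

  comp-lact : ∀ {c a a'} → A.Hom a a' → CompEl c a → CompEl c a'
  comp-lact α (b , p , q) = (b , lact P α p , q)

  comp-ract : ∀ {c c' a} → CompEl c a → C.Hom c' c → CompEl c' a
  comp-ract (b , p , q) γ = (b , p , ract Q q γ)

IsStabilizedComposite : {𝔸 𝔹 ℂ : Groupoid} (𝒜 : Kit 𝔸) (𝒞 : Kit ℂ)
  (P : Profunctor 𝔸 𝔹) (Q : Profunctor 𝔹 ℂ) → Set₁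
IsStabilizedComposite 𝒜 𝒞 P Q =
  StabilizedCond 𝒜 𝒞 (CompEl P Q) (comp-lact P Q) (comp-ract P Q) (_≈Comp_ P Q)

-- Because 𝔹 is a groupoid, two representatives of the same element of the
-- coend ∫^b P(b,a) × Q(c,b) are related by a single morphism of 𝔹, not only
-- by a zigzag. Hence if α · [b, p, q] · γ = [b, p, q], there is one β ∈ End(b)
-- with α · p · β⁻¹ = p and β · q · γ = q, so (α, β⁻¹) stabilizes p and (β, γ)
-- stabilizes q. The two stabilization conditions chain through β, using that
-- ⋃ℬ(b) and ⋃ℬ⊥(b) are closed under inverses.
module Submission where

open import Defs
open import Data.Product using (Σ-syntax; _×_; _,_; proj₁; proj₂)
open import Relation.Binary.PropositionalEquality
open import Relation.Binary.Structures using (IsEquivalence)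
open import Relation.Binary.Construct.Closure.Equivalence using (fold)

module _ {𝔾 : Groupoid} where
  open Groupoid 𝔾

  inv-involutive : ∀ {a b} (f : Hom a b) → inv (inv f) ≡ f
  inv-involutive f = begin
    inv (inv f)                ≡⟨ sym (idʳ _) ⟩
    inv (inv f) ∘ id           ≡⟨ cong (inv (inv f) ∘_) (sym (invˡ f)) ⟩
    inv (inv f) ∘ (inv f ∘ f)  ≡⟨ sym (assoc _ _ _) ⟩
    (inv (inv f) ∘ inv f) ∘ f  ≡⟨ cong (_∘ f) (invˡ (inv f)) ⟩
    id ∘ f                     ≡⟨ idˡ f ⟩
    f                          ∎
    where open ≡-Reasoning

  mem-inv⁻¹ : ∀ {a} (H : Subgroup 𝔾 a) {g : End a} → mem H (inv g) → mem H g
  mem-inv⁻¹ H {g} g⁻¹∈H = subst (mem H) (inv-involutive g) (mem-inv H g⁻¹∈H)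

  ⋃-inv⁻¹ : (𝒦 : Kit 𝔾) {a : Obj} {g : End a} → ⋃ 𝔾 𝒦 a (inv g) → ⋃ 𝔾 𝒦 a g
  ⋃-inv⁻¹ 𝒦 (H , H∈𝒦 , g⁻¹∈H) = H , H∈𝒦 , mem-inv⁻¹ H g⁻¹∈H

  ⋃⊥-inv : (𝒦 : Kit 𝔾) {a : Obj} {g : End a} → ⋃⊥ 𝔾 𝒦 a g → ⋃⊥ 𝔾 𝒦 a (inv g)
  ⋃⊥-inv 𝒦 (H , H⊥𝒦 , g∈H) = H , H⊥𝒦 , mem-inv H g∈H

module _ {𝔸 𝔹 : Groupoid} (P : Profunctor 𝔸 𝔹) where
  private
    module A = Groupoid 𝔸
    module B = Groupoid 𝔹

  ract-ract-inv : ∀ {b b' a} (p : El P b a) (β : B.Hom b' b) →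
                  ract P (ract P p β) (B.inv β) ≡ p
  ract-ract-inv p β = begin
    ract P (ract P p β) (B.inv β)  ≡⟨ sym (ract-∘ P p β (B.inv β)) ⟩
    ract P p (β B.∘ B.inv β)       ≡⟨ cong (ract P p) (B.invʳ β) ⟩
    ract P p B.id                  ≡⟨ ract-id P p ⟩
    p                              ∎
    where open ≡-Reasoning

  lact-inv-lact : ∀ {b a a'} (p : El P b a) (α : A.Hom a a') →
                  lact P (A.inv α) (lact P α p) ≡ p
  lact-inv-lact p α = begin
    lact P (A.inv α) (lact P α p)  ≡⟨ sym (lact-∘ P (A.inv α) α p) ⟩
    lact P (A.inv α A.∘ α) p       ≡⟨ cong (λ α' → lact P α' p) (A.invˡ α) ⟩
    lact P A.id p                  ≡⟨ lact-id P p ⟩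
    p                              ∎
    where open ≡-Reasoning

module _ {𝔸 𝔹 ℂ : Groupoid} (P : Profunctor 𝔸 𝔹) (Q : Profunctor 𝔹 ℂ) where
  private module B = Groupoid 𝔹

  _≃_ : ∀ {c a} → CompEl P Q c a → CompEl P Q c a → Set
  (b , p , q) ≃ (b' , p' , q') =
    Σ[ β ∈ B.Hom b b' ] (ract P p' β ≡ p × lact Q β q ≡ q')

  ≃-isEquivalence : ∀ {c a} → IsEquivalence (_≃_ {c} {a})
  ≃-isEquivalence = record { refl = ≃-refl ; sym = ≃-sym ; trans = ≃-trans }
    where
    ≃-refl : ∀ {x} → x ≃ x
    ≃-refl {b , p , q} = B.id , ract-id P p , lact-id Q q

    ≃-sym : ∀ {x y} → x ≃ y → y ≃ x
    ≃-sym {b , p , q} {b' , p' , q'} (β , refl , refl) =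
      B.inv β , ract-ract-inv P p' β , lact-inv-lact Q q β

    ≃-trans : ∀ {x y z} → x ≃ y → y ≃ z → x ≃ z
    ≃-trans {b , p , q} {b' , p' , q'} {b'' , p'' , q''}
            (β , refl , refl) (β' , refl , refl) =
      β' B.∘ β , ract-∘ P p'' β' β , lact-∘ Q β' β q

  ≈Comp⇒≃ : ∀ {c a} {x y : CompEl P Q c a} → _≈Comp_ P Q x y → x ≃ y
  ≈Comp⇒≃ = fold ≃-isEquivalence λ { (gen β p q) → β , refl , refl }

  coend-stabilizer-split :
    ∀ {a c b} {p : El P b a} {q : El Q c b}
      {α : Groupoid.End 𝔸 a} {γ : Groupoid.End ℂ c} →
    _≈Comp_ P Q (comp-ract P Q (comp-lact P Q α (b , p , q)) γ) (b , p , q) →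
    Σ[ β ∈ B.End b ]
      (ract P (lact P α p) (B.inv β) ≡ p × ract Q (lact Q β q) γ ≡ q)
  coend-stabilizer-split {p = p} {q} {α} {γ} h
    with β , p·β≡α·p , β·q·γ≡q ← ≈Comp⇒≃ h =
    β ,
    trans (cong (λ p' → ract P p' (B.inv β)) (sym p·β≡α·p)) (ract-ract-inv P p β) ,
    trans (sym (lact-ract Q β q γ)) β·q·γ≡q

lemma4p12 : {𝔸 𝔹 ℂ : Groupoid} (𝒜 : Kit 𝔸) (ℬ : Kit 𝔹) (𝒞 : Kit ℂ)
    (P : Profunctor 𝔸 𝔹) (Q : Profunctor 𝔹 ℂ) →
    IsStabilized 𝒜 ℬ P → IsStabilized ℬ 𝒞 Q →
    IsStabilizedComposite 𝒜 𝒞 P Q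
lemma4p12 {𝔸} {𝔹} {ℂ} 𝒜 ℬ 𝒞 P Q P-stable Q-stable a c (b , p , q) α γ h
  with β , α·p·β⁻¹≡p , β·q·γ≡q ← coend-stabilizer-split P Q h =
  (λ α∈⋃𝒜 → proj₁ Q-at-β (⋃-inv⁻¹ ℬ (proj₁ P-at-β⁻¹ α∈⋃𝒜))) ,
  (λ γ∈⋃𝒞⊥ → proj₂ P-at-β⁻¹ (⋃⊥-inv ℬ (proj₂ Q-at-β γ∈⋃𝒞⊥)))
  where
  P-at-β⁻¹ : (⋃ 𝔸 𝒜 a α → ⋃ 𝔹 ℬ b (Groupoid.inv 𝔹 β)) ×
             (⋃⊥ 𝔹 ℬ b (Groupoid.inv 𝔹 β) → ⋃⊥ 𝔸 𝒜 a α)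
  P-at-β⁻¹ = P-stable a b p α (Groupoid.inv 𝔹 β) α·p·β⁻¹≡p
  Q-at-β : (⋃ 𝔹 ℬ b β → ⋃ ℂ 𝒞 c γ) × (⋃⊥ ℂ 𝒞 c γ → ⋃⊥ 𝔹 ℬ b β)
  Q-at-β = Q-stable b c q β γ β·q·γ≡q
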